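{- There exist constants $0<c<C$, an infinite set $I$ of positive integers, and for each $n\in I$ a graph $G_n$ of order $n$ together with a linear ordering of $V(G_n)$, such that \[ c\log n\le \frac{\gamma_g(G_n)}{\gamma(G_n)}\le C\log n\qquad\text{for all } n\in I, \] where $\gamma_g(G_n)$ is computed with respect to the given ordering.
   Context: Graphs are finite, simple and undirected. For a vertex $v$, $N[v]$ denotes its closed neighborhood; for a sequence of vertices, $N[v_1,\dots,v_k]$ is the union of their closed neighborhoods. The domination number $\gamma(G)$ is the minimum size of a set $S\subseteq V(G)$ such that every vertex not in $S$ is adjacent to some vertex of $S$. Given a linear ordering of $V(G)$, the greedy algorithm iteratively selects vertices $x_1,x_2,\dots,x_m$, where $x_k$ is chosen to maximize $|N[x_k]\setminus N[x_1,\dots,x_{k-1}]|$, ties being broken by choosing the vertex earliest in the ordering; it stops as soon as $N[x_1,\dots,x_m]=V(G)$. The greedy domination number $\gamma_g(G)$ is this number $m$. -}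

module Defs where

open import Data.Nat as ℕ using (ℕ; zero; suc)
open import Data.Bool using (Bool; true; false; _∨_)
open import Data.Fin using (Fin; _≟_)
import Data.Fin as Fin
open import Data.Fin.Subset as Sub using (Subset; ∣_∣; _∪_; _∩_; ∁; _∈_)
open import Data.Fin.Permutation using (Permutation′; _⟨$⟩ʳ_)
open import Data.List using (List; []; _∷_; length)
open import Data.Vec using (tabulate)
open import Data.Product using (Σ; _×_; ∃)
open import Data.Sum using (_⊎_)
open import Relation.Nullary using (¬_; does)
open import Relation.Binary.PropositionalEquality using (_≡_)

record Graph (n : ℕ) : Set where
  field
    adj   : Fin n → Fin n → Bool
    sym   : ∀ u v → adj u v ≡ adj v u
    irrefl : ∀ v → adj v v ≡ false
open Graph public

module _ {n : ℕ} (G : Graph n) where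

  N[_] : Fin n → Subset n
  N[ v ] = tabulate (λ u → does (u ≟ v) ∨ adj G v u)

  N⋆ : List (Fin n) → Subset n
  N⋆ []       = Sub.⊥
  N⋆ (x ∷ xs) = N[ x ] ∪ N⋆ xs

  Dominating : Subset n → Set
  Dominating S = ∀ v → v ∈ S ⊎ Σ (Fin n) (λ u → u ∈ S × adj G u v ≡ true)

  IsDominationNumber : ℕ → Set
  IsDominationNumber k =
    Σ (Subset n) (λ S → Dominating S × ∣ S ∣ ≡ k)
    × (∀ S → Dominating S → k ℕ.≤ ∣ S ∣)

  gain : Subset n → Fin n → ℕ
  gain S v = ∣ N[ v ] ∩ ∁ S ∣

  -- The linear ordering of V(G) is given by a permutation π:
  -- vertex v occupies position π ⟨$⟩ʳ v (smaller = earlier).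
  module _ (π : Permutation′ n) where

    GreedyChoice : Subset n → Fin n → Set
    GreedyChoice S x =
      (∀ v → gain S v ℕ.≤ gain S x)
      × (∀ v → gain S v ≡ gain S x → π ⟨$⟩ʳ x Fin.≤ π ⟨$⟩ʳ v)

    -- GreedyRunFrom S xs : starting with dominated set S, the greedy
    -- algorithm selects exactly xs (in order) and then stops.
    GreedyRunFrom : Subset n → List (Fin n) → Set
    GreedyRunFrom S []       = S ≡ Sub.⊤
    GreedyRunFrom S (x ∷ xs) =
      ¬ (S ≡ Sub.⊤) × GreedyChoice S x × GreedyRunFrom (S ∪ N[ x ]) xs

    IsGreedyDominationNumber : ℕ → Set
    IsGreedyDominationNumber m =
      Σ (List (Fin n)) (λ xs → GreedyRunFrom Sub.⊥ xs × length xs ≡ m)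

-- Take two hubs a, b and a clique of spine vertices s₀, …, s_{k-1} joined to both hubs; for
-- every j add on each side a block of 2^j leaves, adjacent to that side's hub and to s_j.
-- The hubs dominate, while the first leaf on side a and the first leaf of the last block on
-- side b have no common neighbour, so γ = 2. Greedy first takes s_{k-1}, which gains
-- k + 2 + 2^k vertices against k + 2^k for a hub. Once the undominated vertices are exactly
-- the leaves of blocks 0, …, i, the spine s_i gains its 2^(i+1) leaves and any other vertex
-- at most 2^(i+1) - 1. All these maxima are unique, so the ordering is irrelevant and
-- γ_g = k, whereas n = 2 + k + 2 (2^k - 1) has ⌊log₂ n⌋ ∈ {k + 1, k + 2}.

module Submission where

open import Defs
open import Data.Nat using (ℕ; _≤_)
open import Data.Nat.Logarithm using (⌊log₂_⌋)
open import Data.Integer using (+_)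
open import Data.Rational using (ℚ; 0ℚ; _/_; _*_) renaming (_≤_ to _≤ℚ_; _<_ to _<ℚ_)
open import Data.Fin.Permutation using (Permutation′)
open import Data.Product using (Σ; _×_)

open import Data.Bool using (Bool; true; false; _∧_; _∨_; not; T)
open import Data.Bool.Properties using (∧-comm; ∧-identityʳ; ∧-zeroʳ; ∨-zeroʳ; not-involutive; T-≡)
open import Data.Empty using (⊥; ⊥-elim)
open import Data.Fin as Fin using (Fin; toℕ; fromℕ<)
open import Data.Fin.Permutation using (_⟨$⟩ʳ_)
import Data.Fin.Permutation as Permutation
open import Data.Fin.Properties using (toℕ-injective; toℕ<n; toℕ-fromℕ<)
import Data.Fin.Properties as Finₚ
open import Data.Fin.Subset as Subset using (Subset; ∣_∣; _∪_; _∩_; ∁; _∈_)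
open import Data.Fin.Subset.Properties using (∣p∣≤∣x∷p∣)
open import Data.Integer as ℤ using ()
import Data.Integer.Properties as ℤₚ
open import Data.List using (List; []; _∷_; length)
open import Data.Nat as ℕ using (zero; suc; _+_; _<_; _^_; _<ᵇ_; _≡ᵇ_; s≤s; z≤n)
open import Data.Nat.Logarithm using (⌊log₂[2^n]⌋≡n; ⌊log₂⌋-mono-≤)
open import Data.Nat.Properties
open import Algebra.Properties.CommutativeSemigroup +-commutativeSemigroup
  using () renaming (x∙yz≈y∙xz to +-left-comm)
open import Data.Nat.Tactic.RingSolver using (solve-∀)
open import Data.Product using (_,_; proj₁; proj₂)
open import Data.Rational using (toℚᵘ)
import Data.Rational.Properties as ℚₚ
open import Data.Rational.Unnormalised as ℚᵘ using (mkℚᵘ; *≤*; _≃_; *≡*)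
import Data.Rational.Unnormalised.Properties as ℚᵘₚ
open import Data.Sum using (_⊎_; inj₁; inj₂)
open import Data.Unit using (⊤; tt)
open import Data.Vec as Vec using (_∷_; tabulate; replicate; zipWith)
open import Data.Vec.Properties using (tabulate-cong; tabulate-∘; tabulate∘lookup; lookup∘tabulate; lookup-replicate; lookup⇒[]=)
open import Function using (_∘_; Equivalence)
open import Relation.Nullary using (does; yes; no)
open import Relation.Nullary.Decidable using (toWitness)
open import Relation.Binary using (tri<; tri≈; tri>)
open import Relation.Binary.PropositionalEquality hiding (sym)
import Relation.Binary.PropositionalEquality as ≡

fromBool : Bool → ℕ
fromBool false = 0
fromBool true  = 1

fromBool≤1 : ∀ b → fromBool b ≤ 1
fromBool≤1 false = z≤n
fromBool≤1 true  = ≤-refl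

count : ℕ → (ℕ → Bool) → ℕ
count zero    P = 0
count (suc n) P = fromBool (P 0) + count n (P ∘ suc)

count-cong : ∀ n {P Q : ℕ → Bool} → (∀ x → P x ≡ Q x) → count n P ≡ count n Q
count-cong zero    P≗Q = refl
count-cong (suc n) P≗Q = cong₂ _+_ (cong fromBool (P≗Q 0)) (count-cong n (P≗Q ∘ suc))

count-none : ∀ n → count n (λ _ → false) ≡ 0
count-none zero    = refl
count-none (suc n) = count-none n

count-all : ∀ n → count n (λ _ → true) ≡ n
count-all zero    = refl
count-all (suc n) = cong suc (count-all n)

count-≤ : ∀ n P → count n P ≤ n
count-≤ zero    P = z≤n
count-≤ (suc n) P = +-mono-≤ (fromBool≤1 (P 0)) (count-≤ n (P ∘ suc))

count-∧ˡ-≤ : ∀ n (P Q : ℕ → Bool) → count n (λ x → P x ∧ Q x) ≤ count n P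
count-∧ˡ-≤ zero    P Q = z≤n
count-∧ˡ-≤ (suc n) P Q = +-mono-≤ (head-≤ (P 0) (Q 0)) (count-∧ˡ-≤ n (P ∘ suc) (Q ∘ suc))
  where
  head-≤ : ∀ a b → fromBool (a ∧ b) ≤ fromBool a
  head-≤ false b = z≤n
  head-≤ true  b = fromBool≤1 b

count-∧ʳ-≤ : ∀ n (P Q : ℕ → Bool) → count n (λ x → P x ∧ Q x) ≤ count n Q
count-∧ʳ-≤ n P Q = ≤-trans (≤-reflexive (count-cong n (λ x → ∧-comm (P x) (Q x)))) (count-∧ˡ-≤ n Q P)

count-<ᵇ : ∀ n h → h ≤ n → count n (λ x → x <ᵇ h) ≡ h
count-<ᵇ n       zero    _         = count-none n
count-<ᵇ (suc n) (suc h) (s≤s h≤n) = cong suc (count-<ᵇ n h h≤n)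

count-<ᵇ-≤ : ∀ n h → count n (λ x → x <ᵇ h) ≤ h
count-<ᵇ-≤ zero    h       = z≤n
count-<ᵇ-≤ (suc n) zero    = ≤-reflexive (count-none n)
count-<ᵇ-≤ (suc n) (suc h) = s≤s (count-<ᵇ-≤ n h)

count-interval : ∀ n lo d → lo + d ≤ n → count n (λ x → (x <ᵇ lo + d) ∧ not (x <ᵇ lo)) ≡ d
count-interval n zero d d≤n =
  trans (count-cong n (λ x → ∧-identityʳ (x <ᵇ d))) (count-<ᵇ n d d≤n)
count-interval (suc n) (suc lo) d (s≤s lo+d≤n) = count-interval n lo d lo+d≤n

count-≢ : ∀ n v → v < n → suc (count n (λ x → not (v ≡ᵇ x))) ≡ n
count-≢ (suc n) zero    _         = cong suc (count-all n)
count-≢ (suc n) (suc v) (s≤s v<n) = cong suc (count-≢ n v v<n)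

-- (y ≡ᵇ v) ∨ A y describes a closed neighbourhood of v; its centre is counted separately.
count-insert : ∀ n v {A B : ℕ → Bool} → v < n → A v ≡ false →
  count n (λ y → B y ∧ ((y ≡ᵇ v) ∨ A y)) ≡ fromBool (B v) + count n (λ y → B y ∧ A y)
count-insert (suc n) zero {A} {B} _ A0
  rewrite A0 | ∧-identityʳ (B 0) | ∧-zeroʳ (B 0) = refl
count-insert (suc n) (suc v) {A} {B} (s≤s v<n) Av = begin
  fromBool (B 0 ∧ A 0) + count n (λ y → B (suc y) ∧ ((y ≡ᵇ v) ∨ A (suc y)))
    ≡⟨ cong (_+_ (fromBool (B 0 ∧ A 0))) (count-insert n v v<n Av) ⟩
  fromBool (B 0 ∧ A 0) + (fromBool (B (suc v)) + count n (λ y → B (suc y) ∧ A (suc y)))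
    ≡⟨ +-left-comm (fromBool (B 0 ∧ A 0)) (fromBool (B (suc v))) _ ⟩
  fromBool (B (suc v)) + (fromBool (B 0 ∧ A 0) + count n (λ y → B (suc y) ∧ A (suc y))) ∎
  where open ≡-Reasoning

splice : {A : Set} → ℕ → (ℕ → A) → (ℕ → A) → ℕ → A
splice zero    f g y       = g y
splice (suc m) f g zero    = f zero
splice (suc m) f g (suc y) = splice m (f ∘ suc) g y

splice-< : ∀ {A : Set} m (f g : ℕ → A) {y} → y < m → splice m f g y ≡ f y
splice-< (suc m) f g {zero}  _         = refl
splice-< (suc m) f g {suc y} (s≤s y<m) = splice-< m (f ∘ suc) g y<m

splice-+ : ∀ {A : Set} m (f g : ℕ → A) w → splice m f g (m + w) ≡ g w
splice-+ zero    f g w = refl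
splice-+ (suc m) f g w = splice-+ m (f ∘ suc) g w

splice-elim : ∀ {A : Set} (P : ℕ → A → Set) m (f g : ℕ → A) →
  (∀ w → w < m → P w (f w)) → (∀ w → P (m + w) (g w)) → ∀ y → P y (splice m f g y)
splice-elim P zero    f g Pf Pg y       = Pg y
splice-elim P (suc m) f g Pf Pg zero    = Pf zero (s≤s z≤n)
splice-elim P (suc m) f g Pf Pg (suc y) =
  splice-elim (P ∘ suc) m (f ∘ suc) g (λ w w<m → Pf (suc w) (s≤s w<m)) Pg y

count-splice : ∀ {A : Set} m r (R : A → Bool) (f g : ℕ → A) →
  count (m + r) (R ∘ splice m f g) ≡ count m (R ∘ f) + count r (R ∘ g)
count-splice zero    r R f g = refl
count-splice (suc m) r R f g =
  trans (cong (_+_ (fromBool (R (f 0)))) (count-splice m r R (f ∘ suc) g))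
        (≡.sym (+-assoc (fromBool (R (f 0))) _ _))


<ᵇ≡true⇒< : ∀ {m n} → (m <ᵇ n) ≡ true → m < n
<ᵇ≡true⇒< {m} {n} e = <ᵇ⇒< m n (Equivalence.from T-≡ e)

<⇒<ᵇ≡true : ∀ {m n} → m < n → (m <ᵇ n) ≡ true
<⇒<ᵇ≡true m<n = Equivalence.to T-≡ (<⇒<ᵇ m<n)

≥⇒<ᵇ≡false : ∀ {m n} → n ≤ m → (m <ᵇ n) ≡ false
≥⇒<ᵇ≡false {m} {n} n≤m with m <ᵇ n in e
... | true  = ⊥-elim (<⇒≱ (<ᵇ≡true⇒< e) n≤m)
... | false = refl

<ᵇ≡false⇒≥ : ∀ {m n} → (m <ᵇ n) ≡ false → n ≤ m
<ᵇ≡false⇒≥ {m} {n} e = ≮⇒≥ (λ m<n → subst T e (<⇒<ᵇ m<n))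

≡ᵇ-refl : ∀ m → (m ≡ᵇ m) ≡ true
≡ᵇ-refl zero    = refl
≡ᵇ-refl (suc m) = ≡ᵇ-refl m

≡ᵇ-sym : ∀ m n → (m ≡ᵇ n) ≡ (n ≡ᵇ m)
≡ᵇ-sym zero    zero    = refl
≡ᵇ-sym zero    (suc n) = refl
≡ᵇ-sym (suc m) zero    = refl
≡ᵇ-sym (suc m) (suc n) = ≡ᵇ-sym m n

≢⇒≡ᵇ≡false : ∀ {m n} → m ≢ n → (m ≡ᵇ n) ≡ false
≢⇒≡ᵇ≡false {m} {n} m≢n with m ≡ᵇ n in e
... | true  = ⊥-elim (m≢n (≡ᵇ⇒≡ m n (Equivalence.from T-≡ e)))
... | false = refl

does-≟ : ∀ {n} (u v : Fin n) → does (u Fin.≟ v) ≡ (toℕ u ≡ᵇ toℕ v)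
does-≟ Fin.zero    Fin.zero    = refl
does-≟ Fin.zero    (Fin.suc v) = refl
does-≟ (Fin.suc u) Fin.zero    = refl
does-≟ (Fin.suc u) (Fin.suc v) = does-≟ u v

zipWith-tabulate : ∀ {n} {A B C : Set} (_⊕_ : A → B → C) (f : Fin n → A) (g : Fin n → B) →
  zipWith _⊕_ (tabulate f) (tabulate g) ≡ tabulate (λ i → f i ⊕ g i)
zipWith-tabulate {zero}  _⊕_ f g = refl
zipWith-tabulate {suc n} _⊕_ f g = cong (f Fin.zero ⊕ g Fin.zero ∷_) (zipWith-tabulate _⊕_ (f ∘ Fin.suc) (g ∘ Fin.suc))

tabulate-const : ∀ {n} {A : Set} (a : A) → tabulate {n = n} (λ _ → a) ≡ replicate n a
tabulate-const a = trans (tabulate-cong (λ i → ≡.sym (lookup-replicate i a))) (tabulate∘lookup _)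

∣tabulate∣ : ∀ n (P : ℕ → Bool) → ∣ tabulate {n = n} (P ∘ toℕ) ∣ ≡ count n P
∣tabulate∣ zero    P = refl
∣tabulate∣ (suc n) P with P 0
... | true  = cong suc (∣tabulate∣ n (P ∘ suc))
... | false = ∣tabulate∣ n (P ∘ suc)

∈⇒1≤∣p∣ : ∀ {n} {p : Subset n} {x} → x ∈ p → 1 ≤ ∣ p ∣
∈⇒1≤∣p∣ {p = _ ∷ p} Vec.here        = s≤s z≤n
∈⇒1≤∣p∣ {p = b ∷ p} (Vec.there x∈p) = ≤-trans (∈⇒1≤∣p∣ x∈p) (∣p∣≤∣x∷p∣ b p)

∈⇒2≤∣p∣ : ∀ {n} {p : Subset n} {x y} → x ∈ p → y ∈ p → x ≢ y → 2 ≤ ∣ p ∣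
∈⇒2≤∣p∣ Vec.here        Vec.here        x≢y = ⊥-elim (x≢y refl)
∈⇒2≤∣p∣ Vec.here        (Vec.there y∈p) _   = s≤s (∈⇒1≤∣p∣ y∈p)
∈⇒2≤∣p∣ (Vec.there x∈p) Vec.here        _   = s≤s (∈⇒1≤∣p∣ x∈p)
∈⇒2≤∣p∣ {p = b ∷ p} (Vec.there x∈p) (Vec.there y∈p) x≢y =
  ≤-trans (∈⇒2≤∣p∣ x∈p y∈p (x≢y ∘ cong Fin.suc)) (∣p∣≤∣x∷p∣ b p)

module _ {n} (G : Graph n) where

  uniqueMax⇒GreedyChoice : ∀ π S x → (∀ v → v ≢ x → gain G S v < gain G S x) → GreedyChoice G π S x
  uniqueMax⇒GreedyChoice π S x max = maximal , earliest
    where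
    maximal : ∀ v → gain G S v ≤ gain G S x
    maximal v with v Fin.≟ x
    ... | yes refl = ≤-refl
    ... | no v≢x   = <⇒≤ (max v v≢x)
    earliest : ∀ v → gain G S v ≡ gain G S x → π ⟨$⟩ʳ x Fin.≤ π ⟨$⟩ʳ v
    earliest v tie with v Fin.≟ x
    ... | yes refl = Finₚ.≤-refl
    ... | no v≢x   = ⊥-elim (<-irrefl tie (max v v≢x))

  Near : Fin n → Fin n → Set
  Near u x = x ≡ u ⊎ adj G x u ≡ true

  dominator : ∀ {S} → Dominating G S → ∀ u → Σ (Fin n) λ x → x ∈ S × Near u x
  dominator dom u with dom u
  ... | inj₁ u∈S             = u , u∈S , inj₁ refl
  ... | inj₂ (x , x∈S , xu) = x , x∈S , inj₂ xu

  disjointNeighbourhoods⇒2≤γ : ∀ u w → (∀ x → Near u x → Near w x → ⊥) →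
    ∀ S → Dominating G S → 2 ≤ ∣ S ∣
  disjointNeighbourhoods⇒2≤γ u w disjoint S dom with dominator dom u | dominator dom w
  ... | x , x∈S , x~u | y , y∈S , y~w =
    ∈⇒2≤∣p∣ x∈S y∈S (λ { refl → disjoint x x~u y~w })

module Labelled {K : Set} (adjK : K → K → Bool) (adjK-sym : ∀ a b → adjK a b ≡ adjK b a)
    (adjK-irrefl : ∀ a → adjK a a ≡ false) (n : ℕ) (label : ℕ → K) where

  ℓ : Fin n → K
  ℓ v = label (toℕ v)

  G : Graph n
  G = record
    { adj    = λ u v → adjK (ℓ u) (ℓ v)
    ; sym    = λ u v → adjK-sym (ℓ u) (ℓ v)
    ; irrefl = adjK-irrefl ∘ ℓ
    }

  -- U flags the labels of the vertices that are not yet dominated.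
  covered : (K → Bool) → Subset n
  covered U = tabulate (λ u → not (U (ℓ u)))

  gain-covered : ∀ U v →
    gain G (covered U) v ≡ fromBool (U (ℓ v)) + count n (λ y → U (label y) ∧ adjK (ℓ v) (label y))
  gain-covered U v = begin
    ∣ N[_] G v ∩ ∁ (covered U) ∣
      ≡⟨ cong (λ S → ∣ N[_] G v ∩ S ∣) (≡.sym (tabulate-∘ not (λ u → not (U (ℓ u))))) ⟩
    ∣ zipWith _∧_ (N[_] G v) (tabulate (λ u → not (not (U (ℓ u))))) ∣
      ≡⟨ cong (∣_∣ {n = n}) (zipWith-tabulate _∧_ _ _) ⟩
    ∣ tabulate {n = n} (λ u → (does (u Fin.≟ v) ∨ adjK (ℓ v) (ℓ u)) ∧ not (not (U (ℓ u)))) ∣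
      ≡⟨ cong (∣_∣ {n = n}) (tabulate-cong pointwise) ⟩
    ∣ tabulate {n = n} (P ∘ toℕ) ∣
      ≡⟨ ∣tabulate∣ n P ⟩
    count n P
      ≡⟨ count-insert n (toℕ v) (toℕ<n v) (adjK-irrefl (ℓ v)) ⟩
    fromBool (U (ℓ v)) + count n (λ y → U (label y) ∧ adjK (ℓ v) (label y)) ∎
    where
    open ≡-Reasoning
    P : ℕ → Bool
    P y = U (label y) ∧ ((y ≡ᵇ toℕ v) ∨ adjK (ℓ v) (label y))
    pointwise : ∀ u → (does (u Fin.≟ v) ∨ adjK (ℓ v) (ℓ u)) ∧ not (not (U (ℓ u))) ≡ P (toℕ u)
    pointwise u rewrite does-≟ u v | not-involutive (U (ℓ u)) = ∧-comm _ (U (ℓ u))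

  covered-∪-N : ∀ {U U'} x → (∀ u → ℓ u ≡ ℓ x → u ≡ x) → U' (ℓ x) ≡ false →
    (∀ u → ℓ u ≢ ℓ x → not (U (ℓ u)) ∨ adjK (ℓ x) (ℓ u) ≡ not (U' (ℓ u))) →
    covered U ∪ N[_] G x ≡ covered U'
  covered-∪-N {U} {U'} x unique U'x update =
    trans (zipWith-tabulate _∨_ _ _) (tabulate-cong pointwise)
    where
    pointwise : ∀ u → not (U (ℓ u)) ∨ (does (u Fin.≟ x) ∨ adjK (ℓ x) (ℓ u)) ≡ not (U' (ℓ u))
    pointwise u with u Fin.≟ x
    ... | yes refl rewrite U'x = ∨-zeroʳ (not (U (ℓ x)))
    ... | no u≢x   = update u (u≢x ∘ unique u)

  covered≢⊤ : ∀ U u → U (ℓ u) ≡ true → covered U ≢ Subset.⊤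
  covered≢⊤ U u Uu covered≡⊤ = subst T (begin
    true                               ≡⟨ lookup-replicate u true ⟨
    Vec.lookup (Subset.⊤ {n = n}) u    ≡⟨ cong (λ S → Vec.lookup S u) covered≡⊤ ⟨
    Vec.lookup (covered U) u           ≡⟨ lookup∘tabulate (λ u → not (U (ℓ u))) u ⟩
    not (U (ℓ u))                      ≡⟨ cong not Uu ⟩
    false                              ∎) tt
    where open ≡-Reasoning

  near-ℓ : ∀ {u x} → Near G u x → ℓ x ≡ ℓ u ⊎ adjK (ℓ x) (ℓ u) ≡ true
  near-ℓ (inj₁ refl) = inj₁ refl
  near-ℓ (inj₂ xu)   = inj₂ xu

data Side : Set where
  left right : Side

sameSide : Side → Side → Bool
sameSide left  left  = true
sameSide right right = true
sameSide _     _     = false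

sameSide-sym : ∀ s s' → sameSide s s' ≡ sameSide s' s
sameSide-sym left  left  = refl
sameSide-sym left  right = refl
sameSide-sym right left  = refl
sameSide-sym right right = refl

data Kind : Set where
  hub   : Side → Kind
  spine : ℕ → Kind
  leaf  : Side → ℕ → Kind

-- Block j of leaf indices is the interval [2^j - 1, 2^(j+1) - 1), of length 2^j.
blockStart : ℕ → ℕ
blockStart zero    = 0
blockStart (suc j) = blockStart j + 2 ^ j

inBlock : ℕ → ℕ → Bool
inBlock j z = (z <ᵇ blockStart (suc j)) ∧ not (z <ᵇ blockStart j)

adjK : Kind → Kind → Bool
adjK (hub _)    (spine _)   = true
adjK (hub s)    (leaf s' _) = sameSide s s'
adjK (spine _)  (hub _)     = true
adjK (spine j)  (spine j')  = not (j ≡ᵇ j')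
adjK (spine j)  (leaf _ z)  = inBlock j z
adjK (leaf s _) (hub s')    = sameSide s s'
adjK (leaf _ z) (spine j)   = inBlock j z
adjK _          _           = false

adjK-sym : ∀ a b → adjK a b ≡ adjK b a
adjK-sym (hub s)    (hub s')    = refl
adjK-sym (hub s)    (spine j)   = refl
adjK-sym (hub s)    (leaf s' z) = sameSide-sym s s'
adjK-sym (spine j)  (hub s)     = refl
adjK-sym (spine j)  (spine j')  = cong not (≡ᵇ-sym j j')
adjK-sym (spine j)  (leaf s z)  = refl
adjK-sym (leaf s z) (hub s')    = sameSide-sym s s'
adjK-sym (leaf s z) (spine j)   = refl
adjK-sym (leaf s z) (leaf s' z') = refl

adjK-irrefl : ∀ a → adjK a a ≡ false
adjK-irrefl (hub s)    = refl
adjK-irrefl (spine j)  = cong not (≡ᵇ-refl j)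
adjK-irrefl (leaf s z) = refl

2^-suc : ∀ j → 2 ^ suc j ≡ 2 ^ j + 2 ^ j
2^-suc j = cong (_+_ (2 ^ j)) (+-identityʳ (2 ^ j))

suc-blockStart : ∀ j → suc (blockStart j) ≡ 2 ^ j
suc-blockStart zero    = refl
suc-blockStart (suc j) = begin
  suc (blockStart j + 2 ^ j) ≡⟨ cong (_+ 2 ^ j) (suc-blockStart j) ⟩
  2 ^ j + 2 ^ j              ≡⟨ 2^-suc j ⟨
  2 ^ suc j                  ∎
  where open ≡-Reasoning

blockStart-mono-≤ : ∀ {i j} → i ≤ j → blockStart i ≤ blockStart j
blockStart-mono-≤ {j = zero} z≤n = ≤-refl
blockStart-mono-≤ {i} {suc j} i≤1+j with m≤n⇒m<n∨m≡n i≤1+j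
... | inj₁ (s≤s i≤j) = ≤-trans (blockStart-mono-≤ i≤j) (m≤m+n (blockStart j) (2 ^ j))
... | inj₂ refl      = ≤-refl

1≤blockStart-suc : ∀ j → 1 ≤ blockStart (suc j)
1≤blockStart-suc j = ≤-trans (m^n>0 2 j) (m≤n+m (2 ^ j) (blockStart j))

≤-blockStart : ∀ j → j ≤ blockStart j
≤-blockStart zero    = z≤n
≤-blockStart (suc j) = subst (_≤ blockStart j + 2 ^ j) (+-comm j 1) (+-mono-≤ (≤-blockStart j) (m^n>0 2 j))

count-inBlock : ∀ n j → blockStart (suc j) ≤ n → count n (inBlock j) ≡ 2 ^ j
count-inBlock n j = count-interval n (blockStart j) (2 ^ j)

inBlock⇒< : ∀ {j z} → inBlock j z ≡ true → z < blockStart (suc j)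
inBlock⇒< {j} {z} e with z <ᵇ blockStart (suc j) in lt
... | true = <ᵇ≡true⇒< lt

inBlock⇒≥ : ∀ {j z} → inBlock j z ≡ true → blockStart j ≤ z
inBlock⇒≥ {j} {z} e with z <ᵇ blockStart (suc j) | z <ᵇ blockStart j in lt
... | true | false = <ᵇ≡false⇒≥ lt

module Construction (t : ℕ) where

  k : ℕ
  k = 2 + t

  Q : ℕ
  Q = blockStart k

  n : ℕ
  n = 2 + (k + (Q + Q))

  -- Beyond n, label runs into improper leaves; Proper picks out the labels that occur.
  label : ℕ → Kind
  label 0             = hub left
  label 1             = hub right
  label (suc (suc y)) = splice k spine (splice Q (leaf left) (leaf right)) y

  position : Kind → ℕ
  position (hub left)    = 0
  position (hub right)   = 1
  position (spine j)     = 2 + j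
  position (leaf left z)  = 2 + (k + z)
  position (leaf right z) = 2 + (k + (Q + z))

  Proper : Kind → Set
  Proper (hub _)    = ⊤
  Proper (spine j)  = j < k
  Proper (leaf _ z) = z < Q

  label-position : ∀ κ → Proper κ → label (position κ) ≡ κ
  label-position (hub left)     _   = refl
  label-position (hub right)    _   = refl
  label-position (spine j)      j<k = splice-< k spine _ j<k
  label-position (leaf left z)  z<Q =
    trans (splice-+ k spine _ z) (splice-< Q (leaf left) (leaf right) z<Q)
  label-position (leaf right z) _   =
    trans (splice-+ k spine _ (Q + z)) (splice-+ Q (leaf left) (leaf right) z)

  position-< : ∀ κ → Proper κ → position κ < n
  position-< (hub left)     _   = s≤s z≤n
  position-< (hub right)    _   = s≤s (s≤s z≤n)
  position-< (spine j)      j<k = s≤s (s≤s (≤-trans j<k (m≤m+n k (Q + Q))))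
  position-< (leaf left z)  z<Q = s≤s (s≤s (+-monoʳ-< k (≤-trans z<Q (m≤m+n Q Q))))
  position-< (leaf right z) z<Q = s≤s (s≤s (+-monoʳ-< k (+-monoʳ-< Q z<Q)))

  label-proper : ∀ y → y < n → Proper (label y) × position (label y) ≡ y
  label-proper 0             _               = tt , refl
  label-proper 1             _               = tt , refl
  label-proper (suc (suc y)) (s≤s (s≤s y<))  =
    splice-elim P k spine _ (λ w w<k _ → w<k , refl)
      (splice-elim (P ∘ (_+_ k)) Q (leaf left) (leaf right) (λ w w<Q _ → w<Q , refl)
        (λ w Q+w< → +-cancelˡ-< Q w Q (+-cancelˡ-< k (Q + w) (Q + Q) Q+w<) , refl))
      y y<
    where
    P : ℕ → Kind → Set
    P w κ = w < k + (Q + Q) → Proper κ × position κ ≡ 2 + w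

  open Labelled adjK adjK-sym adjK-irrefl n label public

  ℓ-proper : ∀ v → Proper (ℓ v)
  ℓ-proper v = proj₁ (label-proper (toℕ v) (toℕ<n v))

  ℓ-injective : ∀ u v → ℓ u ≡ ℓ v → u ≡ v
  ℓ-injective u v ℓu≡ℓv = toℕ-injective (begin
    toℕ u            ≡⟨ proj₂ (label-proper (toℕ u) (toℕ<n u)) ⟨
    position (ℓ u)   ≡⟨ cong position ℓu≡ℓv ⟩
    position (ℓ v)   ≡⟨ proj₂ (label-proper (toℕ v) (toℕ<n v)) ⟩
    toℕ v            ∎)
    where open ≡-Reasoning

  vertex : ∀ κ → Proper κ → Fin n
  vertex κ p = fromℕ< (position-< κ p)

  ℓ-vertex : ∀ κ p → ℓ (vertex κ p) ≡ κ
  ℓ-vertex κ p = trans (cong label (toℕ-fromℕ< (position-< κ p))) (label-position κ p)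

  blockStart-suc≤Q : ∀ {j} → j < k → blockStart (suc j) ≤ Q
  blockStart-suc≤Q = blockStart-mono-≤

  0<Q : 0 < Q
  0<Q = 1≤blockStart-suc (suc t)

  Q≤2^k : Q ≤ 2 ^ k
  Q≤2^k = ≤-trans (n≤1+n Q) (≤-reflexive (suc-blockStart k))


  countK : (Kind → Bool) → ℕ
  countK R = fromBool (R (hub left)) + (fromBool (R (hub right))
    + (count k (R ∘ spine) + (count Q (R ∘ leaf left) + count Q (R ∘ leaf right))))

  count-label : ∀ R → count n (R ∘ label) ≡ countK R
  count-label R = cong (λ c → fromBool (R (hub left)) + (fromBool (R (hub right)) + c))
    (trans (count-splice k (Q + Q) R spine _)
           (cong (_+_ (count k (R ∘ spine))) (count-splice Q Q R (leaf left) (leaf right))))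

  gainK : (Kind → Bool) → Kind → ℕ
  gainK U κ = fromBool (U κ) + countK (λ κ' → U κ' ∧ adjK κ κ')

  gain-ℓ : ∀ U v → gain G (covered U) v ≡ gainK U (ℓ v)
  gain-ℓ U v = trans (gain-covered U v) (cong (_+_ (fromBool (U (ℓ v)))) (count-label (λ κ → U κ ∧ adjK (ℓ v) κ)))

  greedyStep : ∀ {U U' xs} i (i<k : i < k) B →
    (∀ κ → Proper κ → κ ≢ spine i → gainK U κ ≤ B) → B < gainK U (spine i) →
    U' (spine i) ≡ false →
    (∀ κ → Proper κ → κ ≢ spine i → not (U κ) ∨ adjK (spine i) κ ≡ not (U' κ)) →
    U (leaf left 0) ≡ true →
    GreedyRunFrom G Permutation.id (covered U') xs →
    GreedyRunFrom G Permutation.id (covered U) (vertex (spine i) i<k ∷ xs)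
  greedyStep {U} {U'} {xs} i i<k B gain≤B B<gain U'-spine update uncovered run =
      covered≢⊤ U (vertex (leaf left 0) 0<Q) (trans (cong U (ℓ-vertex _ 0<Q)) uncovered)
    , uniqueMax⇒GreedyChoice G Permutation.id (covered U) x unique-max
    , subst (λ S → GreedyRunFrom G Permutation.id S xs)
        (≡.sym (covered-∪-N {U} {U'} x (λ u → ℓ-injective u x) (trans (cong U' ℓx) U'-spine) update′))
        run
    where
    x : Fin n
    x = vertex (spine i) i<k
    ℓx : ℓ x ≡ spine i
    ℓx = ℓ-vertex (spine i) i<k
    other : ∀ {u} → u ≢ x → ℓ u ≢ spine i
    other u≢x ℓu≡ = u≢x (ℓ-injective _ x (trans ℓu≡ (≡.sym ℓx)))
    unique-max : ∀ v → v ≢ x → gain G (covered U) v < gain G (covered U) x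
    unique-max v v≢x rewrite gain-ℓ U v | gain-ℓ U x | ℓx =
      ≤-<-trans (gain≤B (ℓ v) (ℓ-proper v) (other v≢x)) B<gain
    update′ : ∀ u → ℓ u ≢ ℓ x → not (U (ℓ u)) ∨ adjK (ℓ x) (ℓ u) ≡ not (U' (ℓ u))
    update′ u ℓu≢ℓx = subst (λ κ → not (U (ℓ u)) ∨ adjK κ (ℓ u) ≡ not (U' (ℓ u))) (≡.sym ℓx)
      (update (ℓ u) (ℓ-proper u) (λ e → ℓu≢ℓx (trans e (≡.sym ℓx))))

  all : Kind → Bool
  all _ = true

  below : ℕ → Kind → Bool
  below h (leaf _ z) = z <ᵇ h
  below h _          = false

  module FirstStep where
    open ≤-Reasoning

    B : ℕ
    B = suc (k + 2 ^ k)

    B<gain : B < gainK all (spine (suc t))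
    B<gain = ≤-reflexive (cong (_+_ 3) (≡.sym (begin-equality
      count k (λ j → not (suc t ≡ᵇ j)) + (count Q (inBlock (suc t)) + count Q (inBlock (suc t)))
        ≡⟨ cong₂ _+_ (suc-injective (count-≢ k (suc t) ≤-refl)) (cong₂ _+_ blockSize blockSize) ⟩
      suc t + (2 ^ suc t + 2 ^ suc t)
        ≡⟨ cong (_+_ (suc t)) (2^-suc (suc t)) ⟨
      suc t + 2 ^ k ∎)))
      where
      blockSize : count Q (inBlock (suc t)) ≡ 2 ^ suc t
      blockSize = count-inBlock Q (suc t) ≤-refl

    spine-bound : ∀ {j} → j ≤ t → 2 + (k + (2 ^ j + 2 ^ j)) ≤ k + 2 ^ k
    spine-bound {j} j≤t = begin
      2 + (k + (2 ^ j + 2 ^ j))    ≡⟨ +-left-comm 2 k (2 ^ j + 2 ^ j) ⟩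
      k + (2 + (2 ^ j + 2 ^ j))    ≤⟨ +-monoʳ-≤ k (+-mono-≤ (^-monoʳ-≤ 2 {1} {suc t} (s≤s z≤n))
                                        (≤-trans (≤-reflexive (≡.sym (2^-suc j))) (^-monoʳ-≤ 2 (s≤s j≤t)))) ⟩
      k + (2 ^ suc t + 2 ^ suc t)  ≡⟨ cong (_+_ k) (2^-suc (suc t)) ⟨
      k + 2 ^ k                    ∎

    leaf-bound : 2 + (k + 0) ≤ k + 2 ^ k
    leaf-bound = begin
      2 + (k + 0)  ≡⟨ trans (cong (_+_ 2) (+-identityʳ k)) (+-comm 2 k) ⟩
      k + 2        ≤⟨ +-monoʳ-≤ k (^-monoʳ-≤ 2 {1} {k} (s≤s z≤n)) ⟩
      k + 2 ^ k    ∎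

    gain≤B : ∀ κ → Proper κ → κ ≢ spine (suc t) → gainK all κ ≤ B
    gain≤B (hub left) _ _ = begin
      suc (count k (λ _ → true) + (count Q (λ _ → true) + count Q (λ _ → false)))
        ≡⟨ cong suc (cong₂ _+_ (count-all k) (cong₂ _+_ (count-all Q) (count-none Q))) ⟩
      suc (k + (Q + 0))
        ≤⟨ s≤s (+-monoʳ-≤ k (≤-trans (≤-reflexive (+-identityʳ Q)) Q≤2^k)) ⟩
      B ∎
    gain≤B (hub right) _ _ = begin
      suc (count k (λ _ → true) + (count Q (λ _ → false) + count Q (λ _ → true)))
        ≡⟨ cong suc (cong₂ _+_ (count-all k) (cong₂ _+_ (count-none Q) (count-all Q))) ⟩
      suc (k + Q)
        ≤⟨ s≤s (+-monoʳ-≤ k Q≤2^k) ⟩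
      B ∎
    gain≤B (spine j) j<k j≢ = begin
      3 + (count k (λ j' → not (j ≡ᵇ j')) + (count Q (inBlock j) + count Q (inBlock j)))
        ≤⟨ +-monoʳ-≤ 3 (+-mono-≤ (count-≤ k (λ j' → not (j ≡ᵇ j'))) (≤-reflexive (cong₂ _+_ blockSize blockSize))) ⟩
      3 + (k + (2 ^ j + 2 ^ j))
        ≤⟨ s≤s (spine-bound (≤-pred (≤∧≢⇒< (≤-pred j<k) (j≢ ∘ cong spine)))) ⟩
      B ∎
      where
      blockSize : count Q (inBlock j) ≡ 2 ^ j
      blockSize = count-inBlock Q j (blockStart-suc≤Q j<k)
    gain≤B (leaf s z) _ _ = begin
      suc (fromBool (sameSide s left) + (fromBool (sameSide s right)
        + (count k (λ j → inBlock j z) + (count Q (λ _ → false) + count Q (λ _ → false)))))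
        ≤⟨ s≤s (+-mono-≤ (fromBool≤1 (sameSide s left)) (+-mono-≤ (fromBool≤1 (sameSide s right))
             (+-mono-≤ (count-≤ k (λ j → inBlock j z)) (≤-reflexive (cong₂ _+_ (count-none Q) (count-none Q)))))) ⟩
      3 + (k + 0)
        ≤⟨ s≤s leaf-bound ⟩
      B ∎

    update : ∀ κ → Proper κ → κ ≢ spine (suc t) →
      not (all κ) ∨ adjK (spine (suc t)) κ ≡ not (below (blockStart (suc t)) κ)
    update (hub s)    _   _  = refl
    update (spine j)  _   j≢ = cong not (≢⇒≡ᵇ≡false (j≢ ∘ cong spine ∘ ≡.sym))
    update (leaf s z) z<Q _  rewrite <⇒<ᵇ≡true z<Q = refl

  -- Later steps: only the leaves below h are undominated

  module LaterStep (i : ℕ) (i<k : i < k) where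
    open ≤-Reasoning

    h : ℕ
    h = blockStart (suc i)

    freshLeaves : ℕ → ℕ
    freshLeaves j = count Q (λ z → (z <ᵇ h) ∧ inBlock j z)

    gain-spine : ∀ j → gainK (below h) (spine j) ≡ freshLeaves j + freshLeaves j
    gain-spine j = cong (_+ (freshLeaves j + freshLeaves j)) (count-none k)

    freshLeaves-i : freshLeaves i ≡ 2 ^ i
    freshLeaves-i = trans (count-cong Q inside) (count-inBlock Q i (blockStart-suc≤Q i<k))
      where
      inside : ∀ z → (z <ᵇ h) ∧ ((z <ᵇ h) ∧ not (z <ᵇ blockStart i)) ≡ (z <ᵇ h) ∧ not (z <ᵇ blockStart i)
      inside z with z <ᵇ h
      ... | true  = refl
      ... | false = refl

    freshLeaves-< : ∀ {j} → j < i → freshLeaves j ≤ 2 ^ j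
    freshLeaves-< {j} j<i = ≤-trans (count-∧ʳ-≤ Q (λ z → z <ᵇ h) (inBlock j))
      (≤-reflexive (count-inBlock Q j (blockStart-suc≤Q (<-trans j<i i<k))))

    freshLeaves-> : ∀ {j} → i < j → freshLeaves j ≡ 0
    freshLeaves-> {j} i<j = trans (count-cong Q outside) (count-none Q)
      where
      outside : ∀ z → (z <ᵇ h) ∧ ((z <ᵇ blockStart (suc j)) ∧ not (z <ᵇ blockStart j)) ≡ false
      outside z with z <ᵇ h in z<h
      ... | false = refl
      ... | true rewrite <⇒<ᵇ≡true (<-≤-trans (<ᵇ≡true⇒< z<h) (blockStart-mono-≤ i<j)) = ∧-zeroʳ _

    count-below-∧-false : count Q (λ z → (z <ᵇ h) ∧ false) ≡ 0
    count-below-∧-false = trans (count-cong Q (λ z → ∧-zeroʳ (z <ᵇ h))) (count-none Q)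

    count-below-∧-true : count Q (λ z → (z <ᵇ h) ∧ true) ≤ h
    count-below-∧-true = ≤-trans (count-∧ˡ-≤ Q (λ z → z <ᵇ h) (λ _ → true)) (count-<ᵇ-≤ Q h)

    h<gain : h < gainK (below h) (spine i)
    h<gain = ≤-reflexive (begin-equality
      suc (blockStart i) + 2 ^ i  ≡⟨ cong (_+ 2 ^ i) (suc-blockStart i) ⟩
      2 ^ i + 2 ^ i               ≡⟨ cong₂ _+_ freshLeaves-i freshLeaves-i ⟨
      freshLeaves i + freshLeaves i           ≡⟨ gain-spine i ⟨
      gainK (below h) (spine i)   ∎)

    gain≤h : ∀ κ → Proper κ → κ ≢ spine i → gainK (below h) κ ≤ h
    gain≤h (hub left) _ _ = begin
      count k (λ _ → false) + (count Q (λ z → (z <ᵇ h) ∧ true) + count Q (λ z → (z <ᵇ h) ∧ false))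
        ≡⟨ cong₂ _+_ (count-none k) (cong (_+_ (count Q (λ z → (z <ᵇ h) ∧ true))) count-below-∧-false) ⟩
      count Q (λ z → (z <ᵇ h) ∧ true) + 0
        ≡⟨ +-identityʳ _ ⟩
      count Q (λ z → (z <ᵇ h) ∧ true)
        ≤⟨ count-below-∧-true ⟩
      h ∎
    gain≤h (hub right) _ _ = begin
      count k (λ _ → false) + (count Q (λ z → (z <ᵇ h) ∧ false) + count Q (λ z → (z <ᵇ h) ∧ true))
        ≡⟨ cong₂ _+_ (count-none k) (cong (_+ count Q (λ z → (z <ᵇ h) ∧ true)) count-below-∧-false) ⟩
      count Q (λ z → (z <ᵇ h) ∧ true)
        ≤⟨ count-below-∧-true ⟩
      h ∎
    gain≤h (spine j) _ j≢i with <-cmp j i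
    ... | tri≈ _ j≡i _ = ⊥-elim (j≢i (cong spine j≡i))
    ... | tri< j<i _ _ = begin
      gainK (below h) (spine j)  ≡⟨ gain-spine j ⟩
      freshLeaves j + freshLeaves j          ≤⟨ +-mono-≤ (freshLeaves-< j<i) (freshLeaves-< j<i) ⟩
      2 ^ j + 2 ^ j              ≡⟨ 2^-suc j ⟨
      2 ^ suc j                  ≤⟨ ^-monoʳ-≤ 2 j<i ⟩
      2 ^ i                      ≤⟨ m≤n+m (2 ^ i) (blockStart i) ⟩
      h                          ∎
    ... | tri> _ _ i<j = begin
      gainK (below h) (spine j)  ≡⟨ gain-spine j ⟩
      freshLeaves j + freshLeaves j          ≡⟨ cong₂ _+_ (freshLeaves-> i<j) (freshLeaves-> i<j) ⟩
      0                          ≤⟨ z≤n ⟩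
      h                          ∎
    gain≤h (leaf s z) _ _ = begin
      fromBool (z <ᵇ h) + (count k (λ _ → false)
        + (count Q (λ z' → (z' <ᵇ h) ∧ false) + count Q (λ z' → (z' <ᵇ h) ∧ false)))
        ≡⟨ cong (_+_ (fromBool (z <ᵇ h))) (cong₂ _+_ (count-none k) (cong₂ _+_ count-below-∧-false count-below-∧-false)) ⟩
      fromBool (z <ᵇ h) + 0
        ≤⟨ +-monoˡ-≤ 0 (fromBool≤1 (z <ᵇ h)) ⟩
      1
        ≤⟨ 1≤blockStart-suc i ⟩
      h ∎

    update : ∀ κ → Proper κ → κ ≢ spine i → not (below h κ) ∨ adjK (spine i) κ ≡ not (below (blockStart i) κ)
    update (hub s)    _ _ = refl
    update (spine j)  _ _ = refl
    update (leaf s z) _ _ = leaf-update z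
      where
      leaf-update : ∀ z → not (z <ᵇ h) ∨ ((z <ᵇ h) ∧ not (z <ᵇ blockStart i)) ≡ not (z <ᵇ blockStart i)
      leaf-update z with z <ᵇ h in z≮h
      ... | true  = refl
      ... | false rewrite ≥⇒<ᵇ≡false (≤-trans (m≤m+n (blockStart i) (2 ^ i)) (<ᵇ≡false⇒≥ z≮h)) = refl

    uncovered : below h (leaf left 0) ≡ true
    uncovered = <⇒<ᵇ≡true (1≤blockStart-suc i)


  picks : ∀ i → i ≤ k → List (Fin n)
  picks zero    _   = []
  picks (suc i) i<k = vertex (spine i) i<k ∷ picks i (<⇒≤ i<k)

  length-picks : ∀ i (i≤k : i ≤ k) → length (picks i i≤k) ≡ i
  length-picks zero    _   = refl
  length-picks (suc i) i<k = cong suc (length-picks i (<⇒≤ i<k))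

  run : ∀ i (i≤k : i ≤ k) → GreedyRunFrom G Permutation.id (covered (below (blockStart i))) (picks i i≤k)
  run zero    _   = trans (tabulate-cong (λ u → cong not (below-0 (ℓ u)))) (tabulate-const true)
    where
    below-0 : ∀ κ → below 0 κ ≡ false
    below-0 (hub _)    = refl
    below-0 (spine _)  = refl
    below-0 (leaf _ _) = refl
  run (suc i) i<k = greedyStep i i<k (LaterStep.h i i<k) (LaterStep.gain≤h i i<k) (LaterStep.h<gain i i<k) refl
    (LaterStep.update i i<k) (LaterStep.uncovered i i<k) (run i (<⇒≤ i<k))

  greedyRun : GreedyRunFrom G Permutation.id Subset.⊥ (picks k ≤-refl)
  greedyRun = subst (λ S → GreedyRunFrom G Permutation.id S (picks k ≤-refl)) (tabulate-const false)
    (greedyStep (suc t) ≤-refl FirstStep.B FirstStep.gain≤B FirstStep.B<gain refl FirstStep.update refl (run (suc t) (<⇒≤ ≤-refl)))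

  greedyDominationNumber : IsGreedyDominationNumber G Permutation.id k
  greedyDominationNumber = picks k ≤-refl , greedyRun , length-picks k ≤-refl

  hubs : Subset n
  hubs = tabulate (λ u → toℕ u <ᵇ 2)

  ∈hubs : ∀ {u} → toℕ u < 2 → u ∈ hubs
  ∈hubs {u} u<2 = lookup⇒[]= u hubs (trans (lookup∘tabulate (λ u → toℕ u <ᵇ 2) u) (<⇒<ᵇ≡true u<2))

  hubs-dominating : Dominating G hubs
  hubs-dominating v with ℓ v in ℓv
  ... | hub s        = inj₁ (∈hubs (subst (_< 2) (trans (cong position (≡.sym ℓv)) position-ℓv) (hub<2 s)))
    where
    position-ℓv : position (ℓ v) ≡ toℕ v
    position-ℓv = proj₂ (label-proper (toℕ v) (toℕ<n v))
    hub<2 : ∀ s → position (hub s) < 2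
    hub<2 left  = s≤s z≤n
    hub<2 right = s≤s (s≤s z≤n)
  ... | spine j      = inj₂ (Fin.zero , ∈hubs (s≤s z≤n) , refl)
  ... | leaf left z  = inj₂ (Fin.zero , ∈hubs (s≤s z≤n) , refl)
  ... | leaf right z = inj₂ (Fin.suc Fin.zero , ∈hubs (s≤s (s≤s z≤n)) , refl)

  ∣hubs∣ : ∣ hubs ∣ ≡ 2
  ∣hubs∣ = trans (∣tabulate∣ n (λ y → y <ᵇ 2)) (count-<ᵇ n 2 (s≤s (s≤s z≤n)))

  far : ℕ
  far = blockStart (suc t)

  far<Q : far < Q
  far<Q = m<m+n far (m^n>0 2 (suc t))

  disjoint-kinds : ∀ κ → (κ ≡ leaf left 0 ⊎ adjK κ (leaf left 0) ≡ true) →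
    (κ ≡ leaf right far ⊎ adjK κ (leaf right far) ≡ true) → ⊥
  disjoint-kinds _           (inj₁ refl) (inj₁ ())
  disjoint-kinds _           (inj₁ refl) (inj₂ ())
  disjoint-kinds _           (inj₂ ())   (inj₁ refl)
  disjoint-kinds (hub left)  (inj₂ _)    (inj₂ ())
  disjoint-kinds (hub right) (inj₂ ())   (inj₂ _)
  disjoint-kinds (leaf _ _)  (inj₂ ())   (inj₂ _)
  disjoint-kinds (spine zero)    (inj₂ _)  (inj₂ e) = <⇒≱ (inBlock⇒< {0} e) (1≤blockStart-suc t)
  disjoint-kinds (spine (suc j)) (inj₂ e) (inj₂ _)  = <⇒≱ (1≤blockStart-suc j) (inBlock⇒≥ {suc j} e)

  domination : IsDominationNumber G 2
  domination = (hubs , hubs-dominating , ∣hubs∣) , disjointNeighbourhoods⇒2≤γ G u w disjoint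
    where
    u w : Fin n
    u = vertex (leaf left 0) 0<Q
    w = vertex (leaf right far) far<Q
    near : ∀ {x} κ p → Near G (vertex κ p) x → ℓ x ≡ κ ⊎ adjK (ℓ x) κ ≡ true
    near {x} κ p = subst (λ κ → ℓ x ≡ κ ⊎ adjK (ℓ x) κ ≡ true) (ℓ-vertex κ p) ∘ near-ℓ
    disjoint : ∀ x → Near G u x → Near G w x → ⊥
    disjoint x x~u x~w = disjoint-kinds (ℓ x) (near _ 0<Q x~u) (near _ far<Q x~w)


  t≤n : t ≤ n
  t≤n = ≤-trans (m≤n+m t 2) (≤-trans (m≤m+n k (Q + Q)) (m≤n+m (k + (Q + Q)) 2))

  2^[1+k]≡2+[Q+Q] : 2 ^ suc k ≡ 2 + (Q + Q)
  2^[1+k]≡2+[Q+Q] = begin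
    2 ^ suc k        ≡⟨ 2^-suc k ⟩
    2 ^ k + 2 ^ k    ≡⟨ cong₂ _+_ (suc-blockStart k) (suc-blockStart k) ⟨
    suc Q + suc Q    ≡⟨ cong suc (+-suc Q Q) ⟩
    2 + (Q + Q)      ∎
    where open ≡-Reasoning

  2^[1+k]≤n : 2 ^ suc k ≤ n
  2^[1+k]≤n = subst (_≤ n) (≡.sym 2^[1+k]≡2+[Q+Q]) (+-monoʳ-≤ 2 (m≤n+m (Q + Q) k))

  n≤2^[2+k] : n ≤ 2 ^ suc (suc k)
  n≤2^[2+k] = begin
    2 + (k + (Q + Q))                ≤⟨ +-monoʳ-≤ 2 (+-monoˡ-≤ (Q + Q) (≤-blockStart k)) ⟩
    2 + (Q + (Q + Q))                ≤⟨ m≤m+n _ (2 + Q) ⟩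
    2 + (Q + (Q + Q)) + (2 + Q)      ≡⟨ rearrange Q ⟩
    (2 + (Q + Q)) + (2 + (Q + Q))    ≡⟨ cong₂ _+_ 2^[1+k]≡2+[Q+Q] 2^[1+k]≡2+[Q+Q] ⟨
    2 ^ suc k + 2 ^ suc k            ≡⟨ 2^-suc (suc k) ⟨
    2 ^ suc (suc k)                  ∎
    where
    open ≤-Reasoning
    rearrange : ∀ Q → 2 + (Q + (Q + Q)) + (2 + Q) ≡ (2 + (Q + Q)) + (2 + (Q + Q))
    rearrange = solve-∀

  1+k≤lg : suc k ≤ ⌊log₂ n ⌋
  1+k≤lg = subst (_≤ ⌊log₂ n ⌋) (⌊log₂[2^n]⌋≡n (suc k)) (⌊log₂⌋-mono-≤ 2^[1+k]≤n)

  lg≤2+k : ⌊log₂ n ⌋ ≤ suc (suc k)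
  lg≤2+k = subst (⌊log₂ n ⌋ ≤_) (⌊log₂[2^n]⌋≡n (suc (suc k))) (⌊log₂⌋-mono-≤ n≤2^[2+k])

  lg*2≤k*4 : 1 ℕ.* ⌊log₂ n ⌋ ℕ.* 2 ≤ k ℕ.* 4
  lg*2≤k*4 = ≤-trans (*-monoˡ-≤ 2 (*-monoʳ-≤ 1 lg≤2+k)) (subst (1 ℕ.* (4 + t) ℕ.* 2 ≤_) (rearrange t) (m≤m+n _ (t + t)))
    where
    rearrange : ∀ t → 1 ℕ.* (4 + t) ℕ.* 2 + (t + t) ≡ (2 + t) ℕ.* 4
    rearrange = solve-∀

  k*2≤lg*2 : k ℕ.* 2 ≤ 1 ℕ.* ⌊log₂ n ⌋ ℕ.* 2
  k*2≤lg*2 = *-monoˡ-≤ 2 (subst (k ≤_) (≡.sym (*-identityˡ ⌊log₂ n ⌋)) (≤-trans (n≤1+n k) 1+k≤lg))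

toℚᵘ-ℕ : ∀ m → toℚᵘ (+ m / 1) ≃ mkℚᵘ (+ m) 0
toℚᵘ-ℕ m = ℚₚ.toℚᵘ-fromℚᵘ (mkℚᵘ (+ m) 0)

toℚᵘ-scaled : ∀ a b L g → toℚᵘ ((+ a / suc b * (+ L / 1)) * (+ g / 1)) ≃ mkℚᵘ (+ (a ℕ.* L ℕ.* g)) b
toℚᵘ-scaled a b L g = ℚᵘₚ.≃-trans homomorphic (*≡* (cong₂ ℤ._*_ (≡.sym pos-*³) denominator))
  where
  homomorphic : toℚᵘ ((+ a / suc b * (+ L / 1)) * (+ g / 1)) ≃ (mkℚᵘ (+ a) b ℚᵘ.* mkℚᵘ (+ L) 0) ℚᵘ.* mkℚᵘ (+ g) 0
  homomorphic = ℚᵘₚ.≃-trans (ℚₚ.toℚᵘ-homo-* (+ a / suc b * (+ L / 1)) (+ g / 1))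
    (ℚᵘₚ.*-cong (ℚᵘₚ.≃-trans (ℚₚ.toℚᵘ-homo-* (+ a / suc b) (+ L / 1))
                  (ℚᵘₚ.*-cong (ℚₚ.toℚᵘ-fromℚᵘ (mkℚᵘ (+ a) b)) (toℚᵘ-ℕ L)))
                (toℚᵘ-ℕ g))
  pos-*³ : + (a ℕ.* L ℕ.* g) ≡ + a ℤ.* + L ℤ.* + g
  pos-*³ = trans (ℤₚ.pos-* (a ℕ.* L) g) (cong (ℤ._* + g) (ℤₚ.pos-* a L))
  denominator : + suc b ≡ + suc (b ℕ.* 1 ℕ.* 1)
  denominator = cong (λ d → + suc d) (≡.sym (trans (*-identityʳ (b ℕ.* 1)) (*-identityʳ b)))

scaled-≤ : ∀ a b L g m → a ℕ.* L ℕ.* g ≤ m ℕ.* suc b → (+ a / suc b * (+ L / 1)) * (+ g / 1) ≤ℚ + m / 1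
scaled-≤ a b L g m h = ℚₚ.toℚᵘ-cancel-≤ (ℚᵘₚ.≤-respʳ-≃ (ℚᵘₚ.≃-sym (toℚᵘ-ℕ m))
  (ℚᵘₚ.≤-respˡ-≃ (ℚᵘₚ.≃-sym (toℚᵘ-scaled a b L g))
    (*≤* (subst₂ ℤ._≤_ (≡.sym (ℤₚ.*-identityʳ _)) (ℤₚ.pos-* m (suc b)) (ℤ.+≤+ h)))))

scaled-≥ : ∀ a b L g m → m ℕ.* suc b ≤ a ℕ.* L ℕ.* g → + m / 1 ≤ℚ (+ a / suc b * (+ L / 1)) * (+ g / 1)
scaled-≥ a b L g m h = ℚₚ.toℚᵘ-cancel-≤ (ℚᵘₚ.≤-respˡ-≃ (ℚᵘₚ.≃-sym (toℚᵘ-ℕ m))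
  (ℚᵘₚ.≤-respʳ-≃ (ℚᵘₚ.≃-sym (toℚᵘ-scaled a b L g))
    (*≤* (subst₂ ℤ._≤_ (ℤₚ.pos-* m (suc b)) (≡.sym (ℤₚ.*-identityʳ _)) (ℤ.+≤+ h)))))

corollary6 : Σ ℚ λ c → Σ ℚ λ C → 0ℚ <ℚ c × c <ℚ C
    × ((m : ℕ) → Σ ℕ λ n → m ≤ n
        × Σ (Graph n) λ G → Σ (Permutation′ n) λ π
        → Σ ℕ λ g → Σ ℕ λ gg
        → IsDominationNumber G g × IsGreedyDominationNumber G π gg
        × (c * (+ ⌊log₂ n ⌋ / 1)) * (+ g / 1) ≤ℚ (+ gg / 1)
        × (+ gg / 1) ≤ℚ (C * (+ ⌊log₂ n ⌋ / 1)) * (+ g / 1))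
corollary6 = + 1 / 4 , + 1 / 2 , toWitness {a? = 0ℚ ℚₚ.<? + 1 / 4} tt , toWitness {a? = + 1 / 4 ℚₚ.<? + 1 / 2} tt ,
  λ m → let open Construction m in
    n , t≤n , G , Permutation.id , 2 , k , domination , greedyDominationNumber ,
    scaled-≤ 1 3 ⌊log₂ n ⌋ 2 k lg*2≤k*4 , scaled-≥ 1 1 ⌊log₂ n ⌋ 2 k k*2≤lg*2
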